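{- The pushdown automaton $M$ accepts (on empty stack) exactly the language $\mathcal L\$=\{w\$ \mid w\in\mathcal L\}$.
   Context: For a word $u$ and letters $a,b$, $D_{a,b}(u)$ = (number of $a$'s in $u$) minus (number of $b$'s in $u$). For $k\in\mathbb N$, $\mathcal L_{k,\infty}$ is the set of $w\in\{\rho,\lambda,\mu\}^*$ with $D_{\rho,\lambda}(u)\in[0,k]$ and $D_{\lambda,\mu}(u)\ge0$ for all prefixes $u$ of $w$, and $D_{\rho,\lambda}(w)=D_{\lambda,\mu}(w)=0$. The language $\mathcal L$ is the set of words $w\in\mathcal L_{2,\infty}$ that (i) do not contain the factor $\rho\mu$, (ii) do not have a prefix $w_0\rho\lambda w_1\lambda\mu$ with $w_1\in\mathcal L_{1,\infty}$ and $D_{\rho,\lambda}(w_0)=1$, and (iii) do not have a prefix $w_0\lambda\rho w_1\lambda\mu$ with $w_1\in\mathcal L_{1,\infty}$ and $D_{\rho,\lambda}(w_0)=1$. $M$ is the deterministic pushdown automaton accepting on empty stack with states $q_0,\dots,q_8$, start state $q_0$, input alphabet $\{\rho,\lambda,\mu,\$\}$, stack alphabet $\{0,1,2\}$, initial stack consisting of the single symbol $0$. A configuration is $(q,\omega)$ with $\omega$ the stack contents (first letter = top). A transition $\delta(q_i,a,k)=(q_j,\gamma)$ means: in configuration $(q_i,k\omega)$ reading input letter $a$, move to $(q_j,\gamma\omega)$. An input word is accepted if it can be read entirely and the stack is empty after reading it (the stack empties exactly when the whole input is consumed); if no transition applies, the input is rejected. The transitions (with $i$ ranging over the indicated stack symbols)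 are: $\delta(q_0,\$,0)=(q_0,\epsilon)$; $\delta(q_0,\mu,1)=\delta(q_0,\mu,2)=(q_0,\epsilon)$; $\delta(q_3,\mu,1)=(q_0,\epsilon)$; $\delta(q_4,\mu,1)=\delta(q_4,\mu,2)=(q_4,\epsilon)$; $\delta(q_5,\mu,1)=(q_4,\epsilon)$; $\delta(q_5,\mu,2)=(q_5,\epsilon)$; $\delta(q_0,\rho,i)=(q_1,i)$ for $i\in\{0,1,2\}$; $\delta(q_1,\rho,i)=(q_2,i)$ for $i\in\{0,1,2\}$; $\delta(q_3,\rho,1)=(q_6,1)$; $\delta(q_4,\rho,i)=(q_2,i)$ for $i\in\{0,1,2\}$; $\delta(q_5,\rho,i)=(q_8,i)$ for $i\in\{1,2\}$; $\delta(q_6,\rho,1)=(q_8,1)$; $\delta(q_7,\rho,1)=(q_6,1)$; $\delta(q_1,\lambda,i)=(q_3,1i)$ for $i\in\{0,1,2\}$; $\delta(q_2,\lambda,i)=(q_5,1i)$ for $i\in\{0,1,2\}$; $\delta(q_4,\lambda,i)=(q_3,1i)$ for $i\in\{0,1,2\}$; $\delta(q_5,\lambda,i)=(q_7,1i)$ for $i\in\{1,2\}$; $\delta(q_6,\lambda,1)=(q_7,11)$; $\delta(q_8,\lambda,i)=(q_5,2i)$ for $i\in\{1,2\}$. No other transitions exist. -}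

module Defs where

open import Data.Nat using (ℕ; zero; suc)
open import Data.Integer using (ℤ; +_; _-_; _≤_)
open import Data.List using (List; []; _∷_; _++_; map)
open import Data.Maybe using (Maybe; just; nothing)
open import Data.Product using (_×_; _,_; ∃-syntax)
open import Relation.Nullary using (¬_)
open import Relation.Binary.PropositionalEquality using (_≡_)

data Letter : Set where
  rho lam mu : Letter

count : Letter → List Letter → ℕ
count a [] = 0
count rho (rho ∷ u) = suc (count rho u)
count lam (lam ∷ u) = suc (count lam u)
count mu  (mu  ∷ u) = suc (count mu u)
count a   (_   ∷ u) = count a u

D : Letter → Letter → List Letter → ℤ
D a b u = + count a u - + count b u

InLk∞ : ℕ → List Letter → Set
InLk∞ k w =
  (∀ u v → u ++ v ≡ w →
     (+ 0 ≤ D rho lam u) × (D rho lam u ≤ + k) × (+ 0 ≤ D lam mu u))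
  × (D rho lam w ≡ + 0) × (D lam mu w ≡ + 0)

InL : List Letter → Set
InL w =
  InLk∞ 2 w
  × (¬ (∃[ u ] ∃[ v ] (w ≡ u ++ rho ∷ mu ∷ v)))
  × (¬ (∃[ w₀ ] ∃[ w₁ ] ∃[ v ]
          ((w ≡ w₀ ++ rho ∷ lam ∷ w₁ ++ lam ∷ mu ∷ v)
           × InLk∞ 1 w₁ × (D rho lam w₀ ≡ + 1))))
  × (¬ (∃[ w₀ ] ∃[ w₁ ] ∃[ v ]
          ((w ≡ w₀ ++ lam ∷ rho ∷ w₁ ++ lam ∷ mu ∷ v)
           × InLk∞ 1 w₁ × (D rho lam w₀ ≡ + 1))))

data Sym : Set where
  ρ λ' μ $ : Sym

embed : Letter → Sym
embed rho = ρ
embed lam = λ'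
embed mu  = μ

data State : Set where
  q0 q1 q2 q3 q4 q5 q6 q7 q8 : State

data StackSym : Set where
  s0 s1 s2 : StackSym

δ : State → Sym → StackSym → Maybe (State × List StackSym)
δ q0 $  s0 = just (q0 , [])
δ q0 μ  s1 = just (q0 , [])
δ q0 μ  s2 = just (q0 , [])
δ q3 μ  s1 = just (q0 , [])
δ q4 μ  s1 = just (q4 , [])
δ q4 μ  s2 = just (q4 , [])
δ q5 μ  s1 = just (q4 , [])
δ q5 μ  s2 = just (q5 , [])
δ q0 ρ  i  = just (q1 , i ∷ [])
δ q1 ρ  i  = just (q2 , i ∷ [])
δ q3 ρ  s1 = just (q6 , s1 ∷ [])
δ q4 ρ  i  = just (q2 , i ∷ [])
δ q5 ρ  s1 = just (q8 , s1 ∷ [])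
δ q5 ρ  s2 = just (q8 , s2 ∷ [])
δ q6 ρ  s1 = just (q8 , s1 ∷ [])
δ q7 ρ  s1 = just (q6 , s1 ∷ [])
δ q1 λ' i  = just (q3 , s1 ∷ i ∷ [])
δ q2 λ' i  = just (q5 , s1 ∷ i ∷ [])
δ q4 λ' i  = just (q3 , s1 ∷ i ∷ [])
δ q5 λ' s1 = just (q7 , s1 ∷ s1 ∷ [])
δ q5 λ' s2 = just (q7 , s1 ∷ s2 ∷ [])
δ q6 λ' s1 = just (q7 , s1 ∷ s1 ∷ [])
δ q8 λ' s1 = just (q5 , s2 ∷ s1 ∷ [])
δ q8 λ' s2 = just (q5 , s2 ∷ s2 ∷ [])
δ _  _  _  = nothing

data Reads : State → List StackSym → List Sym → State → List StackSym → Set where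
  done : ∀ {q ω} → Reads q ω [] q ω
  step : ∀ {q k ω a x q₁ γ q' ω'} →
         δ q a k ≡ just (q₁ , γ) →
         Reads q₁ (γ ++ ω) x q' ω' →
         Reads q (k ∷ ω) (a ∷ x) q' ω'

Accepts : List Sym → Set
Accepts x = ∃[ q ] Reads q0 (s0 ∷ []) x q []

-- Membership in 𝓛 splits into a prefix-closed part (Admissible: the bounds of
-- L_{2,∞}, no factor ρμ, no forbidden prefix (ii)/(iii)) and the final
-- condition that level and height vanish (InL⇔Complete).  Forbidden prefixes
-- are detected through armed words, which end with a switch ρλ or λρ at level
-- 1 followed by a word of L_{1,∞}: reading λμ after an armed word is forbidden.
--
-- The invariant Inv q p ω ties a configuration (q, ω) of M to the prefix p
-- read so far: p is admissible, ω records the unmatched λ's of p together with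
-- a mark saying whether they were opened right after an armed word
-- (StackFor), and q records the level of p, whether p is armed and its last
-- letter (StateInv).  The combinatorial core is the behaviour of armedness
-- when μ closes a bracket (armed-after-pop, armed-pop).  From it, every
-- transition preserves Inv and reads an admissible letter (step-sound), every
-- admissible letter has a transition (step-complete), and complete words leave
-- M in q0 with the bottom of the stack (final-config).  Induction along runs
-- (run-sound, run-complete) gives the two inclusions.
module Submission where

open import Defs
open import Data.List using (List; []; _∷_; map; _++_; [_])
open import Data.List.Properties
  using (++-assoc; ++-identityʳ; ∷-injective; ∷ʳ-injective; ∷ʳ-injectiveˡ; ∷ʳ-injectiveʳ)
open import Data.List.Reverse using (reverseView; []; _∶_∶ʳ_)
open import Data.Product using (_×_; _,_; proj₁; proj₂; ∃-syntax)
open import Data.Sum using (_⊎_; inj₁; inj₂)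
open import Data.Empty using (⊥; ⊥-elim)
open import Data.Maybe using (just)
open import Function.Bundles using (_⇔_; mk⇔; Equivalence)
open import Relation.Nullary using (¬_)
open import Relation.Binary.PropositionalEquality hiding ([_])
open import Data.Nat using (ℕ; zero; suc; z≤n; s≤s) renaming (_≤_ to _≤ℕ_)
open import Data.Integer using (ℤ; +_; -[1+_]; _+_; _-_; _≤_; +≤+; 0ℤ; 1ℤ; -1ℤ)
import Data.Integer.Properties as ℤ
open import Data.Integer.Tactic.RingSolver using (solve-∀)

-- level u = |u|_ρ − |u|_λ and height u = |u|_λ − |u|_μ, computed letter by
-- letter so that they are additive on concatenation.

level : List Letter → ℤ
level []        = 0ℤ
level (rho ∷ u) = 1ℤ + level u
level (lam ∷ u) = -1ℤ + level u
level (mu  ∷ u) = level u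

height : List Letter → ℤ
height []        = 0ℤ
height (rho ∷ u) = height u
height (lam ∷ u) = 1ℤ + height u
height (mu  ∷ u) = -1ℤ + height u

level-++ : ∀ u v → level (u ++ v) ≡ level u + level v
level-++ []        v = sym (ℤ.+-identityˡ (level v))
level-++ (rho ∷ u) v = trans (cong (_+_ 1ℤ) (level-++ u v)) (sym (ℤ.+-assoc 1ℤ (level u) (level v)))
level-++ (lam ∷ u) v = trans (cong (_+_ -1ℤ) (level-++ u v)) (sym (ℤ.+-assoc -1ℤ (level u) (level v)))
level-++ (mu  ∷ u) v = level-++ u v

height-++ : ∀ u v → height (u ++ v) ≡ height u + height v
height-++ []        v = sym (ℤ.+-identityˡ (height v))
height-++ (rho ∷ u) v = height-++ u v
height-++ (lam ∷ u) v = trans (cong (_+_ 1ℤ) (height-++ u v)) (sym (ℤ.+-assoc 1ℤ (height u) (height v)))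
height-++ (mu  ∷ u) v = trans (cong (_+_ -1ℤ) (height-++ u v)) (sym (ℤ.+-assoc -1ℤ (height u) (height v)))

private
  shift-left : ∀ (m n : ℤ) → (1ℤ + m) - n ≡ 1ℤ + (m - n)
  shift-left = solve-∀

  shift-right : ∀ (m n : ℤ) → m - (1ℤ + n) ≡ -1ℤ + (m - n)
  shift-right = solve-∀

D-level : ∀ u → D rho lam u ≡ level u
D-level []        = refl
D-level (rho ∷ u) = trans (shift-left  (+ count rho u) (+ count lam u)) (cong (_+_ 1ℤ) (D-level u))
D-level (lam ∷ u) = trans (shift-right (+ count rho u) (+ count lam u)) (cong (_+_ -1ℤ) (D-level u))
D-level (mu  ∷ u) = D-level u

D-height : ∀ u → D lam mu u ≡ height u
D-height []        = refl
D-height (rho ∷ u) = D-height u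
D-height (lam ∷ u) = trans (shift-left  (+ count lam u) (+ count mu u)) (cong (_+_ 1ℤ) (D-height u))
D-height (mu  ∷ u) = trans (shift-right (+ count lam u) (+ count mu u)) (cong (_+_ -1ℤ) (D-height u))

+-cancelʳ : ∀ a b c → a + c ≡ b + c → a ≡ b
+-cancelʳ a b c eq = trans (undo a c) (trans (cong (_- c) eq) (sym (undo b c)))
  where
  undo : ∀ (x y : ℤ) → x ≡ (x + y) - y
  undo = solve-∀

-- a nonnegative integer plus one is never zero: a prefix of nonnegative
-- height followed by a part of height 1 cannot have height 0
nonneg+1≢0 : ∀ {a} → 0ℤ ≤ a → a + 1ℤ ≢ 0ℤ
nonneg+1≢0 {+ zero}  _ ()
nonneg+1≢0 {+ suc n} _ ()

zero-or-one : ∀ {a} → 0ℤ ≤ a → a ≤ 1ℤ → (a ≡ 0ℤ) ⊎ (a ≡ 1ℤ)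
zero-or-one {+ 0}             _ _                = inj₁ refl
zero-or-one {+ 1}             _ _                = inj₂ refl
zero-or-one {+ suc (suc n)}   _ (+≤+ (s≤s ()))
zero-or-one { -[1+ n ]}       () _

levi : ∀ {A : Set} (a b c d : List A) → a ++ b ≡ c ++ d →
  (∃[ m ] (c ≡ a ++ m × b ≡ m ++ d)) ⊎ (∃[ m ] (a ≡ c ++ m × d ≡ m ++ b))
levi []      b c       d eq = inj₁ (c , refl , eq)
levi (x ∷ a) b []      d eq = inj₂ (x ∷ a , refl , sym eq)
levi (x ∷ a) b (y ∷ c) d eq with ∷-injective eq
... | refl , eq′ with levi a b c d eq′
...   | inj₁ (m , e₁ , e₂) = inj₁ (m , cong (x ∷_) e₁ , e₂)
...   | inj₂ (m , e₁ , e₂) = inj₂ (m , cong (x ∷_) e₁ , e₂)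

factor-∷ʳ : ∀ {A : Set} (p : List A) a u x y v → p ++ [ a ] ≡ u ++ x ∷ y ∷ v →
  (y ≡ a × p ≡ u ++ [ x ]) ⊎ (∃[ v′ ] (p ≡ u ++ x ∷ y ∷ v′))
factor-∷ʳ p a u x y v eq with reverseView v
... | [] with ∷ʳ-injective p (u ++ [ x ]) (trans eq (sym (++-assoc u [ x ] [ y ])))
...   | p≡ux , refl = inj₁ (refl , p≡ux)
factor-∷ʳ p a u x y v eq | v′ ∶ _ ∶ʳ b =
  inj₂ (v′ , proj₁ (∷ʳ-injective p (u ++ x ∷ y ∷ v′) (trans eq (sym (++-assoc u (x ∷ y ∷ v′) [ b ])))))

-- Prefix-closed properties: Prefixes P w says that every prefix of w satisfies P.
-- The paper's conditions "for all prefixes u of w" are all of this form.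

Prefixes : ∀ {A : Set} → (List A → Set) → List A → Set
Prefixes P w = ∀ u v → u ++ v ≡ w → P u

module _ {A : Set} {P : List A → Set} where

  prefixes-whole : ∀ {w} → Prefixes P w → P w
  prefixes-whole {w} h = h w [] (++-identityʳ w)

  prefixes-init : ∀ {x y} → Prefixes P (x ++ y) → Prefixes P x
  prefixes-init {x} {y} h u v eq = h u (v ++ y) (trans (sym (++-assoc u v y)) (cong (_++ y) eq))

  prefixes-tail : ∀ {x y} → Prefixes P (x ++ y) → Prefixes (λ u → P (x ++ u)) y
  prefixes-tail {x} {y} h u v eq = h (x ++ u) v (trans (++-assoc x u v) (cong (x ++_) eq))

  prefixes-++ : ∀ {x y} → Prefixes P x → Prefixes (λ u → P (x ++ u)) y → Prefixes P (x ++ y)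
  prefixes-++ {x} {y} hx hy u v eq with levi u v x y eq
  ... | inj₁ (m , x≡um , _)     = hx u m (sym x≡um)
  ... | inj₂ (m , refl , y≡mv)  = hy m v (sym y≡mv)

  prefixes-[] : P [] → Prefixes P []
  prefixes-[] p []      v eq = p
  prefixes-[] p (_ ∷ _) v ()

  prefixes-∷ʳ : ∀ {x a} → Prefixes P x → P (x ++ [ a ]) → Prefixes P (x ++ [ a ])
  prefixes-∷ʳ {x} {a} hx pxa = prefixes-++ hx last
    where
    last : Prefixes (λ u → P (x ++ u)) [ a ]
    last []          v eq = subst P (sym (++-identityʳ x)) (prefixes-whole hx)
    last (_ ∷ [])    v eq with ∷-injective eq
    ... | refl , _ = pxa
    last (_ ∷ _ ∷ _) v ()

prefixes-map : ∀ {A : Set} {P Q : List A → Set} → (∀ {u} → P u → Q u) →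
  ∀ {w} → Prefixes P w → Prefixes Q w
prefixes-map f h u v eq = f (h u v eq)

Within : ℕ → List Letter → Set
Within k u = (0ℤ ≤ level u) × (level u ≤ + k) × (0ℤ ≤ height u)

within : ∀ {k n} u → n ≤ℕ k → level u ≡ + n → 0ℤ ≤ height u → Within k u
within {k} u n≤k eq h = subst (0ℤ ≤_) (sym eq) (+≤+ z≤n) , subst (_≤ + k) (sym eq) (+≤+ n≤k) , h

Lk : ℕ → List Letter → Set
Lk k w = Prefixes (Within k) w × (level w ≡ 0ℤ) × (height w ≡ 0ℤ)

Lk-[] : ∀ k → Lk k []
Lk-[] k = prefixes-[] (within [] z≤n refl (+≤+ z≤n)) , refl , refl

InLk∞⇒Lk : ∀ {k w} → InLk∞ k w → Lk k w
InLk∞⇒Lk {k} {w} (pw , lw , hw) =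
  (λ u v eq → let (l₀ , l₁ , h₀) = pw u v eq in
     subst (0ℤ ≤_) (D-level u) l₀ , subst (_≤ + k) (D-level u) l₁ , subst (0ℤ ≤_) (D-height u) h₀) ,
  trans (sym (D-level w)) lw , trans (sym (D-height w)) hw

Lk⇒InLk∞ : ∀ {k w} → Lk k w → InLk∞ k w
Lk⇒InLk∞ {k} {w} (pw , lw , hw) =
  (λ u v eq → let (l₀ , l₁ , h₀) = pw u v eq in
     subst (0ℤ ≤_) (sym (D-level u)) l₀ , subst (_≤ + k) (sym (D-level u)) l₁ ,
     subst (0ℤ ≤_) (sym (D-height u)) h₀) ,
  trans (D-level w) lw , trans (D-height w) hw

NonNeg : List Letter → Set
NonNeg u = 0ℤ ≤ height u

-- balanced words: λ and μ match like brackets, ρ is ignored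
Balanced : List Letter → Set
Balanced w = Prefixes NonNeg w × (height w ≡ 0ℤ)

nonneg-prefixes : ∀ {k p} → Prefixes (Within k) p → Prefixes NonNeg p
nonneg-prefixes = prefixes-map (λ b → proj₂ (proj₂ b))

Lk⇒Balanced : ∀ {k w} → Lk k w → Balanced w
Lk⇒Balanced (pw , _ , hw) = nonneg-prefixes pw , hw

-- The complementary prefix of a suffix of height 1 would have height −1.
balanced-suffix : ∀ {w} u s → Balanced w → u ++ s ≡ w → height s ≡ 1ℤ → ⊥
balanced-suffix {w} u s (pw , hw) eq hs = nonneg+1≢0 (pw u s eq) (begin
  height u + 1ℤ        ≡⟨ cong (_+_ (height u)) (sym hs) ⟩
  height u + height s  ≡⟨ sym (height-++ u s) ⟩
  height (u ++ s)      ≡⟨ cong height eq ⟩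
  height w             ≡⟨ hw ⟩
  0ℤ                   ∎)
  where open ≡-Reasoning

balanced-++ : ∀ {x y} → Balanced x → Balanced y → Balanced (x ++ y)
balanced-++ {x} {y} (px , hx) (py , hy) =
  prefixes-++ px (λ u v eq → subst (0ℤ ≤_) (sym (height-++ x u)) (ℤ.+-mono-≤ (prefixes-whole px) (py u v eq))) ,
  trans (height-++ x y) (cong₂ _+_ hx hy)

balanced-ρ : Balanced [ rho ]
balanced-ρ = prefixes-∷ʳ {x = []} (prefixes-[] ℤ.≤-refl) ℤ.≤-refl , refl

height-wrap : ∀ B → height B ≡ 0ℤ → height (lam ∷ B ++ [ mu ]) ≡ 0ℤ
height-wrap B hB = trans (cong (_+_ 1ℤ) (height-++ B [ mu ])) (cong (λ h → 1ℤ + (h + -1ℤ)) hB)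

balanced-wrap : ∀ {B} → Balanced B → Balanced (lam ∷ B ++ [ mu ])
balanced-wrap {B} (pB , hB) = prefixes-++ {x = [ lam ]} opening inside , height-wrap B hB
  where
  opening : Prefixes NonNeg [ lam ]
  opening = prefixes-∷ʳ {x = []} (prefixes-[] ℤ.≤-refl) (+≤+ z≤n)
  inside : Prefixes (λ u → NonNeg (lam ∷ u)) (B ++ [ mu ])
  inside = prefixes-∷ʳ (prefixes-map (λ {u} h → ℤ.≤-trans h (ℤ.i≤j+i (height u) 1ℤ)) pB)
                       (subst (0ℤ ≤_) (sym (height-wrap B hB)) ℤ.≤-refl)

-- the two-letter words ρλ and λρ that start the forbidden patterns (ii), (iii)
data Switch : Letter → Letter → Set where
  rho-lam : Switch rho lam
  lam-rho : Switch lam rho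

-- p ends with a switch at level 1 followed by a word of L_{1,∞};
-- reading λμ after an armed prefix creates a forbidden prefix (ii) or (iii).
Armed : List Letter → Set
Armed p = ∃[ w₀ ] ∃[ x ] ∃[ y ] ∃[ w₁ ]
  (Switch x y × (p ≡ w₀ ++ x ∷ y ∷ w₁) × (level w₀ ≡ 1ℤ) × Lk 1 w₁)

EndsWith : Letter → List Letter → Set
EndsWith a p = ∃[ p′ ] (p ≡ p′ ++ [ a ])

-- p is an armed word followed by λ: a μ now would be forbidden
Loaded : List Letter → Set
Loaded p = ∃[ q ] ((p ≡ q ++ [ lam ]) × Armed q)

NoRhoMu : List Letter → Set
NoRhoMu p = ¬ (∃[ u ] ∃[ v ] (p ≡ u ++ rho ∷ mu ∷ v))

NoForbidden : List Letter → Set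
NoForbidden p = ∀ q v → p ≡ q ++ lam ∷ mu ∷ v → ¬ Armed q

Admissible : List Letter → Set
Admissible p = Prefixes (Within 2) p × NoRhoMu p × NoForbidden p

Extends : List Letter → Letter → Set
Extends p a = Within 2 (p ++ [ a ]) × (a ≡ mu → ¬ EndsWith rho p) × (a ≡ mu → ¬ Loaded p)

admissible-∷ʳ : ∀ {p a} → Admissible p → Extends p a → Admissible (p ++ [ a ])
admissible-∷ʳ {p} {a} (pw , noρμ , noF) (w , ¬endsρ , ¬loaded) = prefixes-∷ʳ pw w , noρμ′ , noF′
  where
  noρμ′ : NoRhoMu (p ++ [ a ])
  noρμ′ (u , v , eq) with factor-∷ʳ p a u rho mu v eq
  ... | inj₁ (refl , p≡uρ) = ¬endsρ refl (u , p≡uρ)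
  ... | inj₂ (v′ , p≡uρμv′) = noρμ (u , v′ , p≡uρμv′)
  noF′ : NoForbidden (p ++ [ a ])
  noF′ q v eq armed with factor-∷ʳ p a q lam mu v eq
  ... | inj₁ (refl , p≡qλ) = ¬loaded refl (q , p≡qλ , armed)
  ... | inj₂ (v′ , p≡qλμv′) = noF q v′ p≡qλμv′ armed

admissible⇒extends : ∀ {p a r} → Admissible (p ++ a ∷ r) → Extends p a
admissible⇒extends {p} {a} {r} (pw , noρμ , noF) = pw (p ++ [ a ]) r (++-assoc p [ a ] r) , ¬endsρ , ¬loaded
  where
  ¬endsρ : a ≡ mu → ¬ EndsWith rho p
  ¬endsρ refl (p′ , refl) = noρμ (p′ , r , ++-assoc p′ [ rho ] (mu ∷ r))
  ¬loaded : a ≡ mu → ¬ Loaded p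
  ¬loaded refl (q , refl , armed) = noF q r (++-assoc q [ lam ] (mu ∷ r)) armed

ForbiddenBy : Letter → Letter → List Letter → Set
ForbiddenBy x y w = ∃[ w₀ ] ∃[ w₁ ] ∃[ v ]
  ((w ≡ w₀ ++ x ∷ y ∷ w₁ ++ lam ∷ mu ∷ v) × InLk∞ 1 w₁ × (D rho lam w₀ ≡ + 1))

forbidden⇒armed : ∀ {x y w} → Switch x y → ForbiddenBy x y w →
  ∃[ q ] ∃[ v ] ((w ≡ q ++ lam ∷ mu ∷ v) × Armed q)
forbidden⇒armed {x} {y} sw (w₀ , w₁ , v , eq , w₁∈L , lw₀) =
  w₀ ++ x ∷ y ∷ w₁ , v , trans eq (sym (++-assoc w₀ (x ∷ y ∷ w₁) (lam ∷ mu ∷ v))) ,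
  (w₀ , x , y , w₁ , sw , refl , trans (sym (D-level w₀)) lw₀ , InLk∞⇒Lk w₁∈L)

armed⇒forbidden : ∀ {q v w} → w ≡ q ++ lam ∷ mu ∷ v → Armed q →
  ∃[ x ] ∃[ y ] (Switch x y × ForbiddenBy x y w)
armed⇒forbidden {v = v} eq (w₀ , x , y , w₁ , sw , refl , lw₀ , w₁∈L) =
  x , y , sw , w₀ , w₁ , v , trans eq (++-assoc w₀ (x ∷ y ∷ w₁) (lam ∷ mu ∷ v)) ,
  Lk⇒InLk∞ w₁∈L , trans (D-level w₀) lw₀

Complete : List Letter → Set
Complete w = Admissible w × (level w ≡ 0ℤ) × (height w ≡ 0ℤ)

InL⇔Complete : ∀ {w} → InL w ⇔ Complete w
InL⇔Complete {w} = mk⇔ to from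
  where
  to : InL w → Complete w
  to (w∈L₂ , noρμ , ¬ii , ¬iii) =
    let (pw , lw , hw) = InLk∞⇒Lk w∈L₂ in (pw , noρμ , noF) , lw , hw
    where
    noF : NoForbidden w
    noF q v eq armed with armed⇒forbidden eq armed
    ... | _ , _ , rho-lam , fb = ¬ii fb
    ... | _ , _ , lam-rho , fb = ¬iii fb
  from : Complete w → InL w
  from ((pw , noρμ , noF) , lw , hw) =
    Lk⇒InLk∞ (pw , lw , hw) , noρμ , forbids rho-lam , forbids lam-rho
    where
    forbids : ∀ {x y} → Switch x y → ¬ ForbiddenBy x y w
    forbids sw fb = let (q , v , eq , armed) = forbidden⇒armed sw fb in noF q v eq armed

level-switch : ∀ {x y} → Switch x y → ∀ u w → level (u ++ x ∷ y ∷ w) ≡ level u + level w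
level-switch {x} {y} sw u w = trans (level-++ u (x ∷ y ∷ w)) (cong (_+_ (level u)) (cancel sw))
  where
  cancel : Switch x y → level (x ∷ y ∷ w) ≡ level w
  cancel rho-lam = ρλ-cancel (level w)
    where ρλ-cancel : ∀ (z : ℤ) → 1ℤ + (-1ℤ + z) ≡ z
          ρλ-cancel = solve-∀
  cancel lam-rho = λρ-cancel (level w)
    where λρ-cancel : ∀ (z : ℤ) → -1ℤ + (1ℤ + z) ≡ z
          λρ-cancel = solve-∀

height-switch : ∀ {x y} → Switch x y → ∀ w → height (x ∷ y ∷ w) ≡ 1ℤ + height w
height-switch rho-lam w = refl
height-switch lam-rho w = refl

armed-level : ∀ {p} → Armed p → level p ≡ 1ℤ
armed-level (w₀ , x , y , w₁ , sw , refl , lw₀ , (_ , lw₁ , _)) =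
  trans (level-switch sw w₀ w₁) (trans (cong₂ _+_ lw₀ lw₁) refl)

-- An armed word has an unmatched λ or the λ of its switch, so its height is positive.
armed-height : ∀ {p} → Prefixes NonNeg p → Armed p → height p ≢ 0ℤ
armed-height pp (w₀ , x , y , w₁ , sw , refl , _ , (_ , _ , hw₁)) hp =
  nonneg+1≢0 (pp w₀ _ refl) (begin
    height w₀ + 1ℤ                         ≡⟨ cong (λ h → height w₀ + (1ℤ + h)) (sym hw₁) ⟩
    height w₀ + (1ℤ + height w₁)           ≡⟨ cong (_+_ (height w₀)) (sym (height-switch sw w₁)) ⟩
    height w₀ + height (x ∷ y ∷ w₁)        ≡⟨ sym (height-++ w₀ (x ∷ y ∷ w₁)) ⟩
    height (w₀ ++ x ∷ y ∷ w₁)              ≡⟨ hp ⟩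
    0ℤ                                     ∎)
  where open ≡-Reasoning

within-resp : ∀ {k u u′} → level u′ ≡ level u → height u′ ≡ height u → Within k u → Within k u′
within-resp {k} el eh (l₀ , l₁ , h₀) =
  subst (0ℤ ≤_) (sym el) l₀ , subst (_≤ + k) (sym el) l₁ , subst (0ℤ ≤_) (sym eh) h₀

Lk-++ : ∀ {k x y} → Lk k x → Lk k y → Lk k (x ++ y)
Lk-++ {k} {x} {y} (px , lx , hx) (py , ly , hy) =
  prefixes-++ px shifted , trans (level-++ x y) (cong₂ _+_ lx ly) , trans (height-++ x y) (cong₂ _+_ hx hy)
  where
  shifted : Prefixes (λ u → Within k (x ++ u)) y
  shifted u v eq = within-resp {u = u} {u′ = x ++ u}
    (trans (level-++ x u) (trans (cong (_+ level u) lx) (ℤ.+-identityˡ _)))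
    (trans (height-++ x u) (trans (cong (_+ height u) hx) (ℤ.+-identityˡ _)))
    (py u v eq)

Lk-wrap : ∀ {k B} → 1 ≤ℕ k → Lk k B → Lk k (rho ∷ lam ∷ B ++ [ mu ])
Lk-wrap {k} {B} 1≤k (pB , lB , hB) = prefixes-++ {x = rho ∷ lam ∷ []} opening inside , level-wrap , height-wrap B hB
  where
  level-wrap : level (rho ∷ lam ∷ B ++ [ mu ]) ≡ 0ℤ
  level-wrap = trans (level-switch rho-lam [] (B ++ [ mu ]))
                 (trans (ℤ.+-identityˡ _) (trans (level-++ B [ mu ]) (trans (ℤ.+-identityʳ _) lB)))
  opening : Prefixes (Within k) (rho ∷ lam ∷ [])
  opening = prefixes-∷ʳ {x = [ rho ]}
              (prefixes-∷ʳ {x = []} (prefixes-[] (within [] z≤n refl ℤ.≤-refl))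
                                    (within [ rho ] 1≤k refl ℤ.≤-refl))
              (within (rho ∷ lam ∷ []) z≤n refl (+≤+ z≤n))
  lift : ∀ {u} → Within k u → Within k (rho ∷ lam ∷ u)
  lift {u} (l₀ , l₁ , h₀) = subst (0ℤ ≤_) (sym e) l₀ , subst (_≤ + k) (sym e) l₁ ,
                            ℤ.≤-trans h₀ (ℤ.i≤j+i (height u) 1ℤ)
    where e = trans (level-switch rho-lam [] u) (ℤ.+-identityˡ _)
  inside : Prefixes (λ u → Within k (rho ∷ lam ∷ u)) (B ++ [ mu ])
  inside = prefixes-∷ʳ (prefixes-map {Q = λ u → Within k (rho ∷ lam ∷ u)} (λ {u} → lift {u}) pB)
             (within-resp {u = []} {u′ = rho ∷ lam ∷ B ++ [ mu ]} level-wrap (height-wrap B hB)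
                          (within [] z≤n refl ℤ.≤-refl))

balanced-μ-suffix : ∀ {B} t s → Balanced B → t ++ s ≡ B ++ [ mu ] → height s ≡ 0ℤ → s ≡ []
balanced-μ-suffix t s bB eq hs with reverseView s
... | []           = refl
... | s′ ∶ _ ∶ʳ c with ∷ʳ-injective (t ++ s′) _ (trans (++-assoc t s′ [ c ]) eq)
...   | ts′≡B , refl = ⊥-elim (balanced-suffix t s′ bB ts′≡B hs′)
  where
  hs′ : height s′ ≡ 1ℤ
  hs′ = +-cancelʳ (height s′) 1ℤ -1ℤ (trans (sym (height-++ s′ [ mu ])) hs)

module Bracket {C B : List Letter} (bB : Balanced B) (L : Lk 1 (C ++ lam ∷ B ++ [ mu ])) where

  private
    pL = proj₁ L

  level-C : level C ≡ 1ℤ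
  level-C with zero-or-one (proj₁ (pL C _ refl)) (proj₁ (proj₂ (pL C _ refl)))
  ... | inj₂ l = l
  ... | inj₁ l with subst (0ℤ ≤_) (trans (level-++ C [ lam ]) (cong (_+ -1ℤ) l))
                         (proj₁ (pL (C ++ [ lam ]) (B ++ [ mu ]) (++-assoc C [ lam ] _)))
  ...   | ()

  height-C : height C ≡ 0ℤ
  height-C = trans (sym (ℤ.+-identityʳ (height C)))
               (trans (cong (_+_ (height C)) (sym (height-wrap B (proj₂ bB))))
                 (trans (sym (height-++ C _)) (proj₂ (proj₂ L))))

  level-after-C : ∀ u → level (C ++ lam ∷ u) ≡ level u
  level-after-C u = trans (level-++ C (lam ∷ u)) (trans (cong (_+ (-1ℤ + level u)) level-C) (cancel (level u)))
    where
    cancel : ∀ (z : ℤ) → 1ℤ + (-1ℤ + z) ≡ z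
    cancel = solve-∀

  B∈L₁ : Lk 1 B
  B∈L₁ = within-B ,
         trans (sym (ℤ.+-identityʳ (level B))) (trans (sym (level-++ B [ mu ]))
           (trans (sym (level-after-C (B ++ [ mu ]))) (proj₁ (proj₂ L)))) ,
         proj₂ bB
    where
    within-prefix : ∀ u v → u ++ v ≡ B → Within 1 (C ++ lam ∷ u)
    within-prefix u v eq = prefixes-tail pL (lam ∷ u) (v ++ [ mu ])
      (cong (lam ∷_) (trans (sym (++-assoc u v [ mu ])) (cong (_++ [ mu ]) eq)))
    within-B : Prefixes (Within 1) B
    within-B u v eq = let (l₀ , l₁ , _) = within-prefix u v eq in
      subst (0ℤ ≤_) (level-after-C u) l₀ , subst (_≤ 1ℤ) (level-after-C u) l₁ , proj₁ bB u v eq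

  init∈L₁ : ∀ {C′} → C ≡ C′ ++ [ rho ] → Lk 1 C′
  init∈L₁ {C′} refl =
    prefixes-init (subst (Prefixes (Within 1)) (++-assoc C′ [ rho ] _) pL) ,
    +-cancelʳ (level C′) 0ℤ 1ℤ (trans (sym (level-++ C′ [ rho ])) level-C) ,
    trans (sym (ℤ.+-identityʳ (height C′))) (trans (sym (height-++ C′ [ rho ])) height-C)

no-switch-μ : ∀ {x} → ¬ Switch x mu
no-switch-μ ()

-- The switch of an armed word (A λ B) μ with B balanced lies inside A: the μ
-- closes the λ after A, so the part of the word after the switch is C λ B μ.
armed-pop-split : ∀ {A B} → Balanced B → Armed ((A ++ lam ∷ B) ++ [ mu ]) →
  ∃[ w₀ ] ∃[ x ] ∃[ y ] ∃[ C ]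
    (Switch x y × (A ≡ w₀ ++ x ∷ y ∷ C) × (level w₀ ≡ 1ℤ) × Lk 1 (C ++ lam ∷ B ++ [ mu ]))
armed-pop-split {A} {B} bB (w₀ , x , y , w₁ , sw , eq , lw₀ , L)
  with levi A (lam ∷ B ++ [ mu ]) (w₀ ++ x ∷ y ∷ []) w₁ eq′
  where
  eq′ : A ++ lam ∷ B ++ [ mu ] ≡ (w₀ ++ x ∷ y ∷ []) ++ w₁
  eq′ = trans (sym (++-assoc A (lam ∷ B) [ mu ])) (trans eq (sym (++-assoc w₀ (x ∷ y ∷ []) w₁)))
... | inj₂ (C , A≡ , w₁≡) =
  w₀ , x , y , C , sw , trans A≡ (++-assoc w₀ (x ∷ y ∷ []) C) , lw₀ , subst (Lk 1) w₁≡ L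
... | inj₁ ([] , A≡ , w₁≡) =
  w₀ , x , y , [] , sw , trans (sym (++-identityʳ A)) (sym A≡) , lw₀ , subst (Lk 1) (sym w₁≡) L
... | inj₁ (_ ∷ m′ , _ , w₁≡) with ∷-injective w₁≡
...   | _ , Bμ≡m′w₁ with balanced-μ-suffix m′ w₁ bB (sym Bμ≡m′w₁) (proj₂ (proj₂ L))
...     | refl = ⊥-elim (no-switch-μ (subst (Switch x) (sym μ≡y) sw))
  where
  μ≡y : mu ≡ y
  μ≡y = proj₂ (∷ʳ-injective (A ++ lam ∷ B) (w₀ ++ [ x ]) (trans eq (sym (++-assoc w₀ [ x ] [ y ]))))

-- The symbol pushed when λ is read after the prefix A: s2 records that
-- A = A′ρ is at level 2 with A′ armed; s1 covers the remaining cases.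
data Marks : List Letter → StackSym → Set where
  after-armed   : ∀ {A′} → level A′ ≡ 1ℤ → Armed A′ → Marks (A′ ++ [ rho ]) s2
  after-unarmed : ∀ {A′} → level A′ ≡ 1ℤ → ¬ Armed A′ → Marks (A′ ++ [ rho ]) s1
  at-level-one  : ∀ {A} → level A ≡ 1ℤ → Marks A s1

armed-after-pop : ∀ {A B s} → Balanced B → Marks A s → Armed ((A ++ lam ∷ B) ++ [ mu ]) →
  (s ≡ s2) × Armed (A ++ lam ∷ B)
armed-after-pop {A} {B} bB mark armed with armed-pop-split bB armed
... | w₀ , x , y , C , sw , A≡ , lw₀ , L = by-mark mark A≡
  where
  open Bracket bB L

  level-2 : ∀ {A} → A ≡ w₀ ++ x ∷ y ∷ C → level A ≡ + 2
  level-2 refl = trans (level-switch sw w₀ C) (cong₂ _+_ lw₀ level-C)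

  armed-init : ∀ {A′} → A′ ++ [ rho ] ≡ w₀ ++ x ∷ y ∷ C → Armed A′
  armed-init {A′} eq with reverseView C
  ... | [] with level-C
  ...   | ()
  armed-init {A′} eq | C′ ∶ _ ∶ʳ c
    with ∷ʳ-injective A′ (w₀ ++ x ∷ y ∷ C′) (trans eq (sym (++-assoc w₀ (x ∷ y ∷ C′) [ c ])))
  ... | A′≡ , refl = w₀ , x , y , C′ , sw , A′≡ , lw₀ , init∈L₁ refl

  by-mark : ∀ {A s} → Marks A s → A ≡ w₀ ++ x ∷ y ∷ C → (s ≡ s2) × Armed (A ++ lam ∷ B)
  by-mark (at-level-one l) A≡ with trans (sym l) (level-2 A≡)
  ... | ()
  by-mark (after-armed {A′} l _) _ =
    refl , (A′ , rho , lam , B , rho-lam , ++-assoc A′ [ rho ] (lam ∷ B) , l , B∈L₁)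
  by-mark (after-unarmed _ ¬armed) A≡ = ⊥-elim (¬armed (armed-init A≡))

-- In an armed word A′ρλB with level A′ = 1 and B balanced, the switch is the
-- displayed ρλ; hence B ∈ L_{1,∞}.
switch-is-last : ∀ {A′ B} → Balanced B → level A′ ≡ 1ℤ → Armed (A′ ++ rho ∷ lam ∷ B) → Lk 1 B
switch-is-last {A′} {B} bB lA′ (w₀ , x , y , w₁ , sw , eq , lw₀ , L)
  with levi A′ (rho ∷ lam ∷ B) w₀ (x ∷ y ∷ w₁) eq
... | inj₁ ([] , _ , refl) = L
... | inj₁ (_ ∷ [] , refl , refl) with trans (sym lw₀) (trans (level-++ A′ [ rho ]) (cong (_+ 1ℤ) lA′))
...   | ()
switch-is-last bB lA′ (w₀ , x , y , w₁ , sw , eq , lw₀ , (_ , _ , hw₁)) | inj₁ (_ ∷ _ ∷ m′ , _ , refl) =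
  ⊥-elim (balanced-suffix m′ (x ∷ y ∷ w₁) bB refl (trans (height-switch sw w₁) (cong (_+_ 1ℤ) hw₁)))
switch-is-last bB lA′ (w₀ , x , y , w₁ , sw , eq , lw₀ , L) | inj₂ ([] , _ , refl) = L
switch-is-last {B = B} bB lA′ (w₀ , x , y , w₁ , sw , eq , lw₀ , (_ , _ , hw₁)) | inj₂ (_ ∷ [] , _ , refl)
  with trans (sym (cong (_+_ 1ℤ) (proj₂ bB))) hw₁
... | ()
switch-is-last {B = B} bB lA′ (w₀ , x , y , w₁ , sw , eq , lw₀ , L) | inj₂ (_ ∷ _ ∷ m′ , _ , refl) =
  ⊥-elim (balanced-suffix m′ (rho ∷ lam ∷ B) (Lk⇒Balanced L) refl (cong (_+_ 1ℤ) (proj₂ bB)))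

armed-pop : ∀ {A B} → Balanced B → Marks A s2 → Armed (A ++ lam ∷ B) → Armed ((A ++ lam ∷ B) ++ [ mu ])
armed-pop {B = B} bB (after-armed {A′} lA′ (w₀ , x , y , C′ , sw , refl , lw₀ , C′∈L₁)) armed =
  w₀ , x , y , C′ ++ rho ∷ lam ∷ B ++ [ mu ] , sw , regroup , lw₀ ,
  Lk-++ C′∈L₁ (Lk-wrap (s≤s z≤n) (switch-is-last bB lA′ (subst Armed (++-assoc A′ [ rho ] (lam ∷ B)) armed)))
  where
  open ≡-Reasoning
  regroup : ((A′ ++ [ rho ]) ++ lam ∷ B) ++ [ mu ] ≡ w₀ ++ x ∷ y ∷ C′ ++ rho ∷ lam ∷ B ++ [ mu ]
  regroup = begin
    ((A′ ++ [ rho ]) ++ lam ∷ B) ++ [ mu ]   ≡⟨ ++-assoc (A′ ++ [ rho ]) (lam ∷ B) [ mu ] ⟩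
    (A′ ++ [ rho ]) ++ lam ∷ B ++ [ mu ]     ≡⟨ ++-assoc A′ [ rho ] (lam ∷ B ++ [ mu ]) ⟩
    A′ ++ rho ∷ lam ∷ B ++ [ mu ]            ≡⟨ ++-assoc w₀ (x ∷ y ∷ C′) (rho ∷ lam ∷ B ++ [ mu ]) ⟩
    w₀ ++ x ∷ y ∷ C′ ++ rho ∷ lam ∷ B ++ [ mu ] ∎

-- Every symbol
-- above the bottom stands for an unmatched λ of p; it carries the mark of the
-- prefix before that λ, and the word read after it is balanced.
data StackFor : List Letter → List StackSym → Set where
  bottom : ∀ {p} → height p ≡ 0ℤ → StackFor p (s0 ∷ [])
  push   : ∀ {A B s ω} → Balanced B → Marks A s → StackFor A ω → StackFor (A ++ lam ∷ B) (s ∷ ω)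

stack-bottom : ∀ {p ω} → StackFor p (s0 ∷ ω) → (height p ≡ 0ℤ) × (ω ≡ [])
stack-bottom (bottom h) = h , refl

stack-at-height-0 : ∀ {p ω} → Prefixes NonNeg p → height p ≡ 0ℤ → StackFor p ω → ω ≡ s0 ∷ []
stack-at-height-0 pp h (bottom _) = refl
stack-at-height-0 pp h (push {A} {B} (_ , hB) _ _) = ⊥-elim (nonneg+1≢0 (pp A (lam ∷ B) refl) (begin
  height A + 1ℤ                  ≡⟨ cong (λ z → height A + (1ℤ + z)) (sym hB) ⟩
  height A + height (lam ∷ B)    ≡⟨ sym (height-++ A (lam ∷ B)) ⟩
  height (A ++ lam ∷ B)          ≡⟨ h ⟩
  0ℤ                             ∎))
  where open ≡-Reasoning

stack-ρ : ∀ {p ω} → StackFor p ω → StackFor (p ++ [ rho ]) ω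
stack-ρ {p} (bottom h) = bottom (trans (height-++ p [ rho ]) (trans (ℤ.+-identityʳ _) h))
stack-ρ (push {A} {B} bB m st) =
  subst (λ p → StackFor p _) (sym (++-assoc A (lam ∷ B) [ rho ])) (push (balanced-++ bB balanced-ρ) m st)

stack-λ : ∀ {p s ω} → Marks p s → StackFor p ω → StackFor (p ++ [ lam ]) (s ∷ ω)
stack-λ = push (prefixes-[] ℤ.≤-refl , refl)

height-pop : ∀ A B → height B ≡ 0ℤ → height ((A ++ lam ∷ B) ++ [ mu ]) ≡ height A
height-pop A B hB = begin
  height ((A ++ lam ∷ B) ++ [ mu ])     ≡⟨ cong height (++-assoc A (lam ∷ B) [ mu ]) ⟩
  height (A ++ lam ∷ B ++ [ mu ])       ≡⟨ height-++ A (lam ∷ B ++ [ mu ]) ⟩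
  height A + height (lam ∷ B ++ [ mu ]) ≡⟨ cong (_+_ (height A)) (height-wrap B hB) ⟩
  height A + 0ℤ                         ≡⟨ ℤ.+-identityʳ (height A) ⟩
  height A                              ∎
  where open ≡-Reasoning

-- μ closes the topmost unmatched λ: the balanced word after the λ below it grows.
stack-μ : ∀ {A B ω} → Balanced B → StackFor A ω → StackFor ((A ++ lam ∷ B) ++ [ mu ]) ω
stack-μ {A} {B} (_ , hB) (bottom h) = bottom (trans (height-pop A B hB) h)
stack-μ {B = B} bB (push {A₂} {B₂} bB₂ m st) =
  subst (λ p → StackFor p _) regroup (push (balanced-++ bB₂ (balanced-wrap bB)) m st)
  where
  regroup : A₂ ++ lam ∷ B₂ ++ lam ∷ B ++ [ mu ] ≡ ((A₂ ++ lam ∷ B₂) ++ lam ∷ B) ++ [ mu ]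
  regroup = sym (trans (++-assoc (A₂ ++ lam ∷ B₂) (lam ∷ B) [ mu ])
                       (++-assoc A₂ (lam ∷ B₂) (lam ∷ B ++ [ mu ])))

level-ρ : ∀ p {l} → level p ≡ l → level (p ++ [ rho ]) ≡ l + 1ℤ
level-ρ p e = trans (level-++ p [ rho ]) (cong (_+ 1ℤ) e)

level-λ : ∀ p {l} → level p ≡ l → level (p ++ [ lam ]) ≡ l + -1ℤ
level-λ p e = trans (level-++ p [ lam ]) (cong (_+ -1ℤ) e)

level-μ : ∀ p {l} → level p ≡ l → level (p ++ [ mu ]) ≡ l
level-μ p e = trans (level-++ p [ mu ]) (trans (ℤ.+-identityʳ _) e)

ends-with-other : ∀ {p a b} → a ≢ b → ¬ EndsWith b (p ++ [ a ])
ends-with-other {p} a≢b (p′ , eq) = a≢b (∷ʳ-injectiveʳ p p′ eq)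

-- an admissible word at level 0 cannot end with ρ (its prefix would be at level −1)
level-0-not-ρ : ∀ {p} → Admissible p → level p ≡ 0ℤ → ¬ EndsWith rho p
level-0-not-ρ (pw , _) l (p′ , refl) = nonneg+1≢0 (proj₁ (pw p′ [ rho ] refl)) (trans (sym (level-ρ p′ refl)) l)

armed-by-switch : ∀ {p x y} → Switch x y → level p ≡ 1ℤ → Armed ((p ++ [ x ]) ++ [ y ])
armed-by-switch {p} {x} {y} sw l = p , x , y , [] , sw , ++-assoc p [ x ] [ y ] , l , Lk-[] 1

armed-ρ : ∀ {p} → Armed (p ++ [ rho ]) → EndsWith lam p
armed-ρ {p} (w₀ , x , y , w₁ , sw , eq , _ , (pw₁ , lw₁ , _)) with reverseView w₁
... | [] with ∷ʳ-injective p (w₀ ++ [ x ]) (trans eq (sym (++-assoc w₀ [ x ] [ y ])))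
...   | p≡w₀x , refl = w₀ , subst (λ z → p ≡ w₀ ++ [ z ]) (first sw) p≡w₀x
  where
  first : ∀ {x} → Switch x rho → x ≡ lam
  first lam-rho = refl
armed-ρ {p} (w₀ , x , y , w₁ , sw , eq , _ , (pw₁ , lw₁ , _)) | w₁′ ∶ _ ∶ʳ c
  with ∷ʳ-injective p (w₀ ++ x ∷ y ∷ w₁′) (trans eq (sym (++-assoc w₀ (x ∷ y ∷ w₁′) [ c ])))
... | _ , refl = ⊥-elim (nonneg+1≢0 (proj₁ (pw₁ w₁′ [ rho ] refl)) (trans (sym (level-ρ w₁′ refl)) lw₁))

loaded-level : ∀ {p} → Loaded p → level p ≡ 0ℤ
loaded-level (q , refl , armed) = level-λ q (armed-level armed)

level-1-not-loaded : ∀ {p} → level p ≡ 1ℤ → ¬ Loaded p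
level-1-not-loaded l ld with trans (sym l) (loaded-level ld)
... | ()

loaded-after : ∀ {p′} → Loaded (p′ ++ [ lam ]) → Armed p′
loaded-after {p′} (q , eq , armed) = subst Armed (sym (∷ʳ-injectiveˡ p′ q eq)) armed

TopIsS1 : List StackSym → Set
TopIsS1 ω = ∃[ ω′ ] (ω ≡ s1 ∷ ω′)

-- What each state of M records about the prefix p read so far: the level of
-- p, whether p (or p without its last letter) is armed, and its last letter.
StateInv : State → List Letter → List StackSym → Set
StateInv q0 p ω = (level p ≡ 0ℤ) × ¬ EndsWith lam p
StateInv q1 p ω = (level p ≡ 1ℤ) × ¬ Armed p × EndsWith rho p
StateInv q2 p ω = ∃[ p′ ] ((p ≡ p′ ++ [ rho ]) × (level p′ ≡ 1ℤ) × ¬ Armed p′)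
StateInv q3 p ω = (∃[ p′ ] ((p ≡ p′ ++ [ lam ]) × (level p′ ≡ 1ℤ) × ¬ Armed p′)) × TopIsS1 ω
StateInv q4 p ω = (level p ≡ 1ℤ) × ¬ Armed p × ¬ EndsWith rho p
StateInv q5 p ω = (level p ≡ 1ℤ) × Armed p × ¬ EndsWith rho p
StateInv q6 p ω = (level p ≡ 1ℤ) × Armed p × EndsWith rho p × TopIsS1 ω
StateInv q7 p ω = (∃[ p′ ] ((p ≡ p′ ++ [ lam ]) × (level p′ ≡ 1ℤ) × Armed p′)) × TopIsS1 ω
StateInv q8 p ω = ∃[ p′ ] ((p ≡ p′ ++ [ rho ]) × (level p′ ≡ 1ℤ) × Armed p′)

record Inv (q : State) (p : List Letter) (ω : List StackSym) : Set where
  constructor inv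
  field
    admissible : Admissible p
    stack      : StackFor p ω
    state      : StateInv q p ω

-- Reading one letter within the level bounds: the longer word is admissible
-- and the stack is updated; only the new state invariant remains to be shown.
read-ρ : ∀ {p ω q′} → Admissible p → StackFor p ω → (level p ≡ 0ℤ) ⊎ (level p ≡ 1ℤ) →
  StateInv q′ (p ++ [ rho ]) ω → Extends p rho × Inv q′ (p ++ [ rho ]) ω
read-ρ {p} adm st l si = ext , inv (admissible-∷ʳ adm ext) (stack-ρ st) si
  where
  h : 0ℤ ≤ height (p ++ [ rho ])
  h = subst (0ℤ ≤_) (sym (trans (height-++ p [ rho ]) (ℤ.+-identityʳ _)))
        (proj₂ (proj₂ (prefixes-whole (proj₁ adm))))
  bounded : (level p ≡ 0ℤ) ⊎ (level p ≡ 1ℤ) → Within 2 (p ++ [ rho ])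
  bounded (inj₁ l) = within (p ++ [ rho ]) (s≤s z≤n) (level-ρ p l) h
  bounded (inj₂ l) = within (p ++ [ rho ]) (s≤s (s≤s z≤n)) (level-ρ p l) h
  ext : Extends p rho
  ext = bounded l , (λ ()) , (λ ())

read-λ : ∀ {p s ω q′} → Admissible p → StackFor p ω → Marks p s → (level p ≡ 1ℤ) ⊎ (level p ≡ + 2) →
  StateInv q′ (p ++ [ lam ]) (s ∷ ω) → Extends p lam × Inv q′ (p ++ [ lam ]) (s ∷ ω)
read-λ {p} adm st m l si = ext , inv (admissible-∷ʳ adm ext) (stack-λ m st) si
  where
  h : 0ℤ ≤ height (p ++ [ lam ])
  h = subst (0ℤ ≤_) (sym (trans (height-++ p [ lam ]) (ℤ.+-comm (height p) 1ℤ)))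
        (ℤ.≤-trans (proj₂ (proj₂ (prefixes-whole (proj₁ adm)))) (ℤ.i≤j+i (height p) 1ℤ))
  bounded : (level p ≡ 1ℤ) ⊎ (level p ≡ + 2) → Within 2 (p ++ [ lam ])
  bounded (inj₁ l) = within (p ++ [ lam ]) z≤n (level-λ p l) h
  bounded (inj₂ l) = within (p ++ [ lam ]) (s≤s z≤n) (level-λ p l) h
  ext : Extends p lam
  ext = bounded l , (λ ()) , (λ ())

read-μ : ∀ {A B ω q′} → let p = A ++ lam ∷ B in
  Admissible p → Balanced B → StackFor A ω → (level p ≡ 0ℤ) ⊎ (level p ≡ 1ℤ) →
  ¬ EndsWith rho p → ¬ Loaded p → StateInv q′ (p ++ [ mu ]) ω → Extends p mu × Inv q′ (p ++ [ mu ]) ω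
read-μ {A} {B} adm bB st l ¬endsρ ¬loaded si = ext , inv (admissible-∷ʳ adm ext) (stack-μ bB st) si
  where
  h : 0ℤ ≤ height ((A ++ lam ∷ B) ++ [ mu ])
  h = subst (0ℤ ≤_) (sym (height-pop A B (proj₂ bB))) (proj₂ (proj₂ (proj₁ adm A (lam ∷ B) refl)))
  bounded : (level (A ++ lam ∷ B) ≡ 0ℤ) ⊎ (level (A ++ lam ∷ B) ≡ 1ℤ) → Within 2 ((A ++ lam ∷ B) ++ [ mu ])
  bounded (inj₁ l) = within ((A ++ lam ∷ B) ++ [ mu ]) z≤n (level-μ (A ++ lam ∷ B) l) h
  bounded (inj₂ l) = within ((A ++ lam ∷ B) ++ [ mu ]) (s≤s z≤n) (level-μ (A ++ lam ∷ B) l) h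
  ext : Extends (A ++ lam ∷ B) mu
  ext = bounded l , (λ _ → ¬endsρ) , (λ _ → ¬loaded)

back-to-level-0 : ∀ {A B ω} → let p = A ++ lam ∷ B in
  Admissible p → Balanced B → StackFor A ω → level p ≡ 0ℤ → ¬ Loaded p →
  Extends p mu × Inv q0 (p ++ [ mu ]) ω
back-to-level-0 {A} {B} adm bB st l ¬loaded =
  read-μ adm bB st (inj₁ l) (level-0-not-ρ adm l) ¬loaded (level-μ (A ++ lam ∷ B) l , ends-with-other (λ ()))

complete-λρ : ∀ {p′ ω} → Admissible (p′ ++ [ lam ]) → StackFor (p′ ++ [ lam ]) (s1 ∷ ω) → level p′ ≡ 1ℤ →
  Extends (p′ ++ [ lam ]) rho × Inv q6 ((p′ ++ [ lam ]) ++ [ rho ]) (s1 ∷ ω)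
complete-λρ {p′} adm st l =
  read-ρ adm st (inj₁ (level-λ p′ l))
    (level-ρ (p′ ++ [ lam ]) (level-λ p′ l) , armed-by-switch lam-rho l , (_ , refl) , (_ , refl))

complete-ρλ : ∀ {p′ s ω} → Admissible (p′ ++ [ rho ]) → StackFor (p′ ++ [ rho ]) ω →
  Marks (p′ ++ [ rho ]) s → level p′ ≡ 1ℤ →
  Extends (p′ ++ [ rho ]) lam × Inv q5 ((p′ ++ [ rho ]) ++ [ lam ]) (s ∷ ω)
complete-ρλ {p′} adm st m l =
  read-λ adm st m (inj₂ (level-ρ p′ l))
    (level-λ (p′ ++ [ rho ]) (level-ρ p′ l) , armed-by-switch rho-lam l , ends-with-other (λ ()))

close-to-q4 : ∀ {A B ω} → let p = A ++ lam ∷ B in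
  Admissible p → Balanced B → StackFor A ω → level p ≡ 1ℤ → ¬ EndsWith rho p → ¬ Armed (p ++ [ mu ]) →
  Extends p mu × Inv q4 (p ++ [ mu ]) ω
close-to-q4 {A} {B} adm bB st l ¬endsρ ¬armed =
  read-μ adm bB st (inj₂ l) ¬endsρ (level-1-not-loaded l)
    (level-μ (A ++ lam ∷ B) l , ¬armed , ends-with-other (λ ()))

sound-ρ : ∀ {q p k ω q′ γ} → Inv q p (k ∷ ω) → δ q ρ k ≡ just (q′ , γ) →
  Extends p rho × Inv q′ (p ++ [ rho ]) (γ ++ ω)
sound-ρ {q0} {p} (inv adm st (l , ¬endsλ)) refl =
  read-ρ adm st (inj₁ l) (level-ρ p l , (λ armed → ¬endsλ (armed-ρ armed)) , (p , refl))
sound-ρ {q1} {p} (inv adm st (l , ¬armed , _)) refl = read-ρ adm st (inj₂ l) (p , refl , l , ¬armed)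
sound-ρ {q3} (inv adm st ((_ , refl , l , _) , (_ , refl))) refl = complete-λρ adm st l
sound-ρ {q4} {p} (inv adm st (l , ¬armed , _)) refl = read-ρ adm st (inj₂ l) (p , refl , l , ¬armed)
sound-ρ {q5} {p} {s1} (inv adm st (l , armed , _)) refl = read-ρ adm st (inj₂ l) (p , refl , l , armed)
sound-ρ {q5} {p} {s2} (inv adm st (l , armed , _)) refl = read-ρ adm st (inj₂ l) (p , refl , l , armed)
sound-ρ {q6} {p} (inv adm st (l , armed , _ , (_ , refl))) refl = read-ρ adm st (inj₂ l) (p , refl , l , armed)
sound-ρ {q7} (inv adm st ((_ , refl , l , _) , (_ , refl))) refl = complete-λρ adm st l

sound-λ : ∀ {q p k ω q′ γ} → Inv q p (k ∷ ω) → δ q λ' k ≡ just (q′ , γ) →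
  Extends p lam × Inv q′ (p ++ [ lam ]) (γ ++ ω)
sound-λ {q1} {p} (inv adm st (l , ¬armed , _)) refl =
  read-λ adm st (at-level-one l) (inj₁ l) ((p , refl , l , ¬armed) , (_ , refl))
sound-λ {q2} (inv adm st (_ , refl , l , ¬armed)) refl = complete-ρλ adm st (after-unarmed l ¬armed) l
sound-λ {q4} {p} (inv adm st (l , ¬armed , _)) refl =
  read-λ adm st (at-level-one l) (inj₁ l) ((p , refl , l , ¬armed) , (_ , refl))
sound-λ {q5} {p} {s1} (inv adm st (l , armed , _)) refl =
  read-λ adm st (at-level-one l) (inj₁ l) ((p , refl , l , armed) , (_ , refl))
sound-λ {q5} {p} {s2} (inv adm st (l , armed , _)) refl =
  read-λ adm st (at-level-one l) (inj₁ l) ((p , refl , l , armed) , (_ , refl))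
sound-λ {q6} {p} (inv adm st (l , armed , _ , (_ , refl))) refl =
  read-λ adm st (at-level-one l) (inj₁ l) ((p , refl , l , armed) , (_ , refl))
sound-λ {q8} {k = s1} (inv adm st (_ , refl , l , armed)) refl = complete-ρλ adm st (after-armed l armed) l
sound-λ {q8} {k = s2} (inv adm st (_ , refl , l , armed)) refl = complete-ρλ adm st (after-armed l armed) l

sound-μ : ∀ {q p k ω q′ γ} → Inv q p (k ∷ ω) → δ q μ k ≡ just (q′ , γ) →
  Extends p mu × Inv q′ (p ++ [ mu ]) (γ ++ ω)
sound-μ {q0} {k = s1} (inv adm (push bB _ st) (l , ¬endsλ)) refl =
  back-to-level-0 adm bB st l (λ (q , e , _) → ¬endsλ (q , e))
sound-μ {q0} {k = s2} (inv adm (push bB _ st) (l , ¬endsλ)) refl =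
  back-to-level-0 adm bB st l (λ (q , e , _) → ¬endsλ (q , e))
sound-μ {q3} (inv adm (push bB _ st) ((p′ , p≡p′λ , l , ¬armed) , (_ , refl))) refl =
  back-to-level-0 adm bB st (trans (cong level p≡p′λ) (level-λ p′ l))
    (λ loaded → ¬armed (loaded-after (subst Loaded p≡p′λ loaded)))
sound-μ {q4} {k = s1} (inv adm (push bB m st) (l , ¬armed , ¬endsρ)) refl =
  close-to-q4 adm bB st l ¬endsρ (λ armed → ¬armed (proj₂ (armed-after-pop bB m armed)))
sound-μ {q4} {k = s2} (inv adm (push bB m st) (l , ¬armed , ¬endsρ)) refl =
  close-to-q4 adm bB st l ¬endsρ (λ armed → ¬armed (proj₂ (armed-after-pop bB m armed)))
sound-μ {q5} {k = s1} (inv adm (push bB m st) (l , _ , ¬endsρ)) refl =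
  close-to-q4 adm bB st l ¬endsρ (λ armed → s1≢s2 (proj₁ (armed-after-pop bB m armed)))
  where
  s1≢s2 : s1 ≢ s2
  s1≢s2 ()
sound-μ {q5} {k = s2} (inv adm (push {A} {B} bB m st) (l , armed , ¬endsρ)) refl =
  read-μ adm bB st (inj₂ l) ¬endsρ (level-1-not-loaded l)
    (level-μ (A ++ lam ∷ B) l , armed-pop bB m armed , ends-with-other (λ ()))

step-sound : ∀ {q p k ω a q′ γ} → Inv q p (k ∷ ω) → δ q (embed a) k ≡ just (q′ , γ) →
  Extends p a × Inv q′ (p ++ [ a ]) (γ ++ ω)
step-sound {a = rho} = sound-ρ
step-sound {a = lam} = sound-λ
step-sound {a = mu}  = sound-μ

Enabled : State → Sym → StackSym → Set
Enabled q a k = ∃[ q′ ] ∃[ γ ] (δ q a k ≡ just (q′ , γ))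

ρ-at-level-2 : ∀ {p} → level p ≡ + 2 → ¬ Extends p rho
ρ-at-level-2 {p} l ((_ , l≤2 , _) , _) with subst (_≤ + 2) (level-ρ p l) l≤2
... | +≤+ (s≤s (s≤s ()))

λ-at-level-0 : ∀ {p} → level p ≡ 0ℤ → ¬ Extends p lam
λ-at-level-0 {p} l ((0≤l , _) , _) with subst (0ℤ ≤_) (level-λ p l) 0≤l
... | ()

μ-at-bottom : ∀ {p ω} → StackFor p (s0 ∷ ω) → ¬ Extends p mu
μ-at-bottom {p} st ((_ , _ , 0≤h) , _)
  with subst (0ℤ ≤_) (trans (height-++ p [ mu ]) (cong (_+ -1ℤ) (proj₁ (stack-bottom st)))) 0≤h
... | ()

μ-after-ρ : ∀ {p} → EndsWith rho p → ¬ Extends p mu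
μ-after-ρ ends (_ , ¬endsρ , _) = ¬endsρ refl ends

-- an armed word has positive height, so its stack is not just the bottom
armed-not-at-bottom : ∀ {p ω} → Admissible p → Armed p → ¬ StackFor p (s0 ∷ ω)
armed-not-at-bottom (pw , _) armed st = armed-height (nonneg-prefixes pw) armed (proj₁ (stack-bottom st))

enabled-ρ : ∀ {q p k ω} → Inv q p (k ∷ ω) → Extends p rho → Enabled q ρ k
enabled-ρ {q0} _ _ = _ , _ , refl
enabled-ρ {q1} _ _ = _ , _ , refl
enabled-ρ {q2} (inv _ _ (p′ , refl , l , _)) ext = ⊥-elim (ρ-at-level-2 (level-ρ p′ l) ext)
enabled-ρ {q3} (inv _ _ (_ , (_ , refl))) _ = _ , _ , refl
enabled-ρ {q4} _ _ = _ , _ , refl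
enabled-ρ {q5} {k = s0} (inv adm st (_ , armed , _)) _ = ⊥-elim (armed-not-at-bottom adm armed st)
enabled-ρ {q5} {k = s1} _ _ = _ , _ , refl
enabled-ρ {q5} {k = s2} _ _ = _ , _ , refl
enabled-ρ {q6} (inv _ _ (_ , _ , _ , (_ , refl))) _ = _ , _ , refl
enabled-ρ {q7} (inv _ _ (_ , (_ , refl))) _ = _ , _ , refl
enabled-ρ {q8} (inv _ _ (p′ , refl , l , _)) ext = ⊥-elim (ρ-at-level-2 (level-ρ p′ l) ext)

enabled-λ : ∀ {q p k ω} → Inv q p (k ∷ ω) → Extends p lam → Enabled q λ' k
enabled-λ {q0} (inv _ _ (l , _)) ext = ⊥-elim (λ-at-level-0 l ext)
enabled-λ {q1} _ _ = _ , _ , refl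
enabled-λ {q2} _ _ = _ , _ , refl
enabled-λ {q3} (inv _ _ ((p′ , refl , l , _) , _)) ext = ⊥-elim (λ-at-level-0 (level-λ p′ l) ext)
enabled-λ {q4} _ _ = _ , _ , refl
enabled-λ {q5} {k = s0} (inv adm st (_ , armed , _)) _ = ⊥-elim (armed-not-at-bottom adm armed st)
enabled-λ {q5} {k = s1} _ _ = _ , _ , refl
enabled-λ {q5} {k = s2} _ _ = _ , _ , refl
enabled-λ {q6} (inv _ _ (_ , _ , _ , (_ , refl))) _ = _ , _ , refl
enabled-λ {q7} (inv _ _ ((p′ , refl , l , _) , _)) ext = ⊥-elim (λ-at-level-0 (level-λ p′ l) ext)
enabled-λ {q8} {k = s0} (inv (pw , _) st (p′ , refl , _ , armed)) _ =
  ⊥-elim (armed-height (nonneg-prefixes (prefixes-init pw)) armed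
           (trans (sym (ℤ.+-identityʳ _)) (trans (sym (height-++ p′ [ rho ])) (proj₁ (stack-bottom st)))))
enabled-λ {q8} {k = s1} _ _ = _ , _ , refl
enabled-λ {q8} {k = s2} _ _ = _ , _ , refl

enabled-μ : ∀ {q p k ω} → Inv q p (k ∷ ω) → Extends p mu → Enabled q μ k
enabled-μ {q0} {k = s0} (inv _ st _) ext = ⊥-elim (μ-at-bottom st ext)
enabled-μ {q0} {k = s1} _ _ = _ , _ , refl
enabled-μ {q0} {k = s2} _ _ = _ , _ , refl
enabled-μ {q1} (inv _ _ (_ , _ , ends)) ext = ⊥-elim (μ-after-ρ ends ext)
enabled-μ {q2} (inv _ _ (p′ , refl , _)) ext = ⊥-elim (μ-after-ρ (p′ , refl) ext)
enabled-μ {q3} (inv _ _ (_ , (_ , refl))) _ = _ , _ , refl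
enabled-μ {q4} {k = s0} (inv _ st _) ext = ⊥-elim (μ-at-bottom st ext)
enabled-μ {q4} {k = s1} _ _ = _ , _ , refl
enabled-μ {q4} {k = s2} _ _ = _ , _ , refl
enabled-μ {q5} {k = s0} (inv _ st _) ext = ⊥-elim (μ-at-bottom st ext)
enabled-μ {q5} {k = s1} _ _ = _ , _ , refl
enabled-μ {q5} {k = s2} _ _ = _ , _ , refl
enabled-μ {q6} (inv _ _ (_ , _ , ends , _)) ext = ⊥-elim (μ-after-ρ ends ext)
enabled-μ {q7} (inv _ _ ((p′ , p≡p′λ , _ , armed) , _)) (_ , _ , ¬loaded) =
  ⊥-elim (¬loaded refl (p′ , p≡p′λ , armed))
enabled-μ {q8} (inv _ _ (p′ , refl , _)) ext = ⊥-elim (μ-after-ρ (p′ , refl) ext)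

step-complete : ∀ {q p k ω a} → Inv q p (k ∷ ω) → Extends p a → Enabled q (embed a) k
step-complete {a = rho} = enabled-ρ
step-complete {a = lam} = enabled-λ
step-complete {a = mu}  = enabled-μ

level-clash : ∀ {a : ℤ} {n} → a ≡ + suc n → a ≡ 0ℤ → ⊥
level-clash l l′ with trans (sym l) l′
... | ()

final-config : ∀ {q p ω} → Inv q p ω → level p ≡ 0ℤ → height p ≡ 0ℤ → (q ≡ q0) × (ω ≡ s0 ∷ [])
final-config {q0} (inv (pw , _) st _) _ h = refl , stack-at-height-0 (nonneg-prefixes pw) h st
final-config {q1} (inv _ _ (l′ , _)) l _ = ⊥-elim (level-clash l′ l)
final-config {q2} (inv _ _ (p′ , refl , l′ , _)) l _ = ⊥-elim (level-clash (level-ρ p′ l′) l)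
final-config {q3} (inv (pw , _) _ ((p′ , refl , _) , _)) _ h =
  ⊥-elim (nonneg+1≢0 (nonneg-prefixes pw p′ [ lam ] refl) (trans (sym (height-++ p′ [ lam ])) h))
final-config {q4} (inv _ _ (l′ , _)) l _ = ⊥-elim (level-clash l′ l)
final-config {q5} (inv _ _ (l′ , _)) l _ = ⊥-elim (level-clash l′ l)
final-config {q6} (inv _ _ (l′ , _)) l _ = ⊥-elim (level-clash l′ l)
final-config {q7} (inv (pw , _) _ ((p′ , refl , _) , _)) _ h =
  ⊥-elim (nonneg+1≢0 (nonneg-prefixes pw p′ [ lam ] refl) (trans (sym (height-++ p′ [ lam ])) h))
final-config {q8} (inv _ _ (p′ , refl , l′ , _)) l _ = ⊥-elim (level-clash (level-ρ p′ l′) l)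

[]≢++∷ : ∀ {A : Set} (u : List A) {x v} → [] ≢ u ++ x ∷ v
[]≢++∷ []      ()
[]≢++∷ (_ ∷ _) ()

initial : Inv q0 [] (s0 ∷ [])
initial = inv []-admissible (bottom refl) (refl , λ (p′ , e) → []≢++∷ p′ e)
  where
  []-admissible : Admissible []
  []-admissible = prefixes-[] (within [] z≤n refl ℤ.≤-refl) ,
                  (λ (u , _ , e) → []≢++∷ u e) , (λ q _ e _ → []≢++∷ q e)

data SymView : Sym → Set where
  end    : SymView $
  letter : ∀ a → SymView (embed a)

sym-view : ∀ s → SymView s
sym-view ρ  = letter rho
sym-view λ' = letter lam
sym-view μ  = letter mu
sym-view $  = end

run-sound : ∀ {q p ω x q′} → Inv q p ω → Reads q ω x q′ [] →
  ∃[ w ] ((x ≡ map embed w ++ [ $ ]) × Complete (p ++ w))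
run-sound (inv _ () _) done
run-sound I (step {a = s} δ≡ run) with sym-view s
run-sound {q0} {p} (inv adm st (l , _)) (step {k = s0} refl run) | end with stack-bottom st
... | h , refl with run
...   | done = [] , refl , subst Complete (sym (++-identityʳ p)) (adm , l , h)
run-sound {p = p} I (step δ≡ run) | letter a with step-sound {a = a} I δ≡
... | _ , I′ with run-sound I′ run
...   | w , refl , complete = a ∷ w , refl , subst Complete (++-assoc p [ a ] w) complete

run-complete : ∀ {q p ω} w → Inv q p ω → Complete (p ++ w) → Reads q ω (map embed w ++ [ $ ]) q0 []
run-complete {p = p} [] I c with subst Complete (++-identityʳ p) c
... | _ , l , h with final-config I l h
...   | refl , refl = step refl done
run-complete {ω = []} (a ∷ w) (inv _ () _) _
run-complete {p = p} {ω = _ ∷ _} (a ∷ w) I c with step-complete {a = a} I (admissible⇒extends (proj₁ c))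
... | _ , _ , δ≡ =
  step δ≡ (run-complete w (proj₂ (step-sound I δ≡)) (subst Complete (sym (++-assoc p [ a ] w)) c))

proposition4p2 : (x : List Sym) →
    Accepts x ⇔ (∃[ w ] (InL w × (x ≡ map embed w ++ [ $ ])))
proposition4p2 x = mk⇔ sound complete
  where
  sound : Accepts x → ∃[ w ] (InL w × (x ≡ map embed w ++ [ $ ]))
  sound (_ , run) with run-sound initial run
  ... | w , x≡ , c = w , Equivalence.from InL⇔Complete c , x≡
  complete : ∃[ w ] (InL w × (x ≡ map embed w ++ [ $ ])) → Accepts x
  complete (w , w∈L , refl) = q0 , run-complete w initial (Equivalence.to InL⇔Complete w∈L)
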